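{- Let $n\ge 2$ and let $D$ be the orientation of the line graph $L(\mu(C_{2n+1}))$ described in the context. Then $D$ is acyclic, i.e., it contains no directed cycle.
   Context: For a graph $G$ with vertex set $[m]=\{1,\dots,m\}$ and edge set $E(G)$, the Mycielski graph $\mu(G)$ has vertex set $[m]\cup\{1',\dots,m'\}\cup\{0\}$ and edge set $E(G)\cup\{\overline{0i'} : i\in[m]\}\cup\{\overline{ji'},\overline{ij'} : \overline{ij}\in E(G)\}$. Here $C_{2n+1}$ is the cycle on $[2n+1]$ with edges $\overline{i(i+1)}$ for $1\le i\le 2n$ and $\overline{1(2n+1)}$. The line graph $L(G)$ has the edges of $G$ as vertices, two being adjacent iff they share an endpoint. Label the vertices of $L(\mu(C_{2n+1}))$ as follows: for an edge $\overline{ij}$ of $C_{2n+1}$ with $i<j$, write $c_{ij}$; for an edge of $\mu(C_{2n+1})$ joining $i\in\{0,1,\dots,2n+1\}$ and $j'$ ($1\le j\le 2n+1$), write $a_{ij'}$. Let $B_{2n+1}$ be the spanning subgraph of $\mu(C_{2n+1})$ consisting of all edges $a_{ij'}$. The orientation $D$ of $L(\mu(C_{2n+1}))$ is: (I) for any two vertices $a_{ij_1'},a_{ij_2'}$ (same $i$) with $j_1<j_2$, orient $a_{ij_1'}\to a_{ij_2'}$; for any two vertices $a_{i_1j'},a_{i_2j'}$ (same $j$) with $i_1>i_2$, orient $a_{i_1j'}\to a_{i_2j'}$; (II) for $1\le i\le 2n-1$, orient $c_{(i+1)(i+2)}\to c_{i(i+1)}$, and orient $c_{1(2n+1)}\to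 c_{12}$ and $c_{(2n)(2n+1)}\to c_{1(2n+1)}$; (III) every edge between a vertex $a_{ij'}$ and a vertex $c_{kl}$ is oriented from $a_{ij'}$ to $c_{kl}$. -}

module Defs where

open import Data.Nat using (ℕ; zero; suc; _+_; _*_; _∸_; _≤_; _<_)
open import Data.Product using (_×_)
open import Data.Sum using (_⊎_)
open import Relation.Binary.PropositionalEquality using (_≡_)

-- N = 2n+1, the length of the odd cycle C_{2n+1} on vertex set [N] = {1,…,N}.
cycLen : ℕ → ℕ
cycLen n = 2 * n + 1

CEdge : ℕ → ℕ → ℕ → Set
CEdge n i j = (1 ≤ i × j ≡ suc i × j ≤ cycLen n) ⊎ (i ≡ 1 × j ≡ cycLen n)

CAdj : ℕ → ℕ → ℕ → Set
CAdj n i j = CEdge n i j ⊎ CEdge n j i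

-- Edge of μ(C_{2n+1}) between i ∈ {0,…,2n+1} and j' (1 ≤ j ≤ 2n+1):
-- present iff i = 0, or ij is an edge of C_{2n+1}.
AEdge : ℕ → ℕ → ℕ → Set
AEdge n i j = (1 ≤ j × j ≤ cycLen n) × (i ≡ 0 ⊎ CAdj n i j)

-- Vertices of L(μ(C_{2n+1})), i.e. edges of μ(C_{2n+1}).
-- The side conditions are irrelevant, so a vertex is determined by its indices.
data Vtx (n : ℕ) : Set where
  c : (i j : ℕ) → .(CEdge n i j) → Vtx n
  a : (i j : ℕ) → .(AEdge n i j) → Vtx n

-- The arcs of the orientation D of L(μ(C_{2n+1})).
-- Each constructor covers exactly one class of adjacent pairs (pairs of
-- edges of μ(C_{2n+1}) sharing an endpoint), oriented as in (I)-(III).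
data Arc (n : ℕ) : Vtx n → Vtx n → Set where
  aa-row : ∀ {i j₁ j₂} .{p q} → j₁ < j₂ → Arc n (a i j₁ p) (a i j₂ q)
  aa-col : ∀ {i₁ i₂ j} .{p q} → i₂ < i₁ → Arc n (a i₁ j p) (a i₂ j q)
  cc-step : ∀ {i} .{p q} → 1 ≤ i → i ≤ 2 * n ∸ 1 →
            Arc n (c (suc i) (suc (suc i)) p) (c i (suc i) q)
  cc-wrap₁ : ∀ .{p q} → Arc n (c 1 (cycLen n) p) (c 1 2 q)
  cc-wrap₂ : ∀ .{p q} → Arc n (c (2 * n) (cycLen n) p) (c 1 (cycLen n) q)
  ac : ∀ {i j k l} .{p q} → (i ≡ k ⊎ i ≡ l) → Arc n (a i j p) (c k l q)

{-# OPTIONS --safe #-}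
-- Rank the vertices of L(μ(C_{2n+1})) so that every arc of D strictly lowers the rank.
-- All c-vertices rank below all a-vertices, which accounts for the arcs (III). Among
-- a-vertices the rank i − j drops along both kinds of arcs (I); among c-vertices the
-- rank i + j drops along the arcs (II), the wrap-around arc c_{(2n)(2n+1)} → c_{1(2n+1)}
-- because 4n + 1 > 2n + 2.
module Submission where

open import Defs
open import Data.Nat as ℕ using (ℕ; _≤_; _<_; _+_; _*_; s≤s)
import Data.Nat.Properties as ℕ
open import Data.Integer as ℤ using (ℤ; _⊖_)
import Data.Integer.Properties as ℤ
open import Data.Sum using (_⊎_; inj₁; inj₂)
open import Data.Sum.Relation.Binary.LeftOrder
  using (_⊎-<_; ₁∼₂; ₁∼₁; ₂∼₂; ⊎-<-isStrictPartialOrder)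
open import Level using (Level)
open import Relation.Binary.Core using (Rel)
open import Relation.Binary.Structures using (IsStrictPartialOrder)
open import Relation.Nullary using (¬_)
open import Relation.Binary.Construct.Closure.Transitive using (TransClosure; [_]; _∷_)

module _ {a b r ℓ₁ ℓ₂ : Level} {A : Set a} {B : Set b} {_⟶_ : Rel A r}
         {_≈_ : Rel B ℓ₁} {_≺_ : Rel B ℓ₂} (spo : IsStrictPartialOrder _≈_ _≺_)
         (rank : A → B) (descends : ∀ {u v} → u ⟶ v → rank v ≺ rank u)
         where

  open IsStrictPartialOrder spo

  descends⁺ : ∀ {u v} → TransClosure _⟶_ u v → rank v ≺ rank u
  descends⁺ [ u⟶v ]      = descends u⟶v
  descends⁺ (u⟶w ∷ w⟶⁺v) = trans (descends⁺ w⟶⁺v) (descends u⟶w)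

  ranked⇒acyclic : ∀ u → ¬ TransClosure _⟶_ u u
  ranked⇒acyclic u u⟶⁺u = irrefl Eq.refl (descends⁺ u⟶⁺u)

_≺_ : Rel (ℕ ⊎ ℤ) _
_≺_ = ℕ._<_ ⊎-< ℤ._<_

≺-isStrictPartialOrder : IsStrictPartialOrder _ _≺_
≺-isStrictPartialOrder = ⊎-<-isStrictPartialOrder ℕ.<-isStrictPartialOrder ℤ.<-isStrictPartialOrder

rank : ∀ {n} → Vtx n → ℕ ⊎ ℤ
rank (c i j _) = inj₁ (i + j)
rank (a i j _) = inj₂ (i ⊖ j)

1<2*n : ∀ {n} → 1 ≤ n → 1 < 2 * n
1<2*n 1≤n = ℕ.*-monoʳ-≤ 2 1≤n

rank-descends : ∀ {n} → 1 ≤ n → ∀ {u v} → Arc n u v → rank v ≺ rank u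
rank-descends 1≤n (aa-row {i} j₁<j₂) = ₂∼₂ (ℤ.⊖-monoʳ->-< i j₁<j₂)
rank-descends 1≤n (aa-col {j = j} i₂<i₁) = ₂∼₂ (ℤ.⊖-monoˡ-< j i₂<i₁)
rank-descends 1≤n (cc-step {i} _ _) = ₁∼₁ (s≤s (ℕ.+-monoʳ-≤ i (ℕ.n≤1+n (ℕ.suc i))))
rank-descends 1≤n cc-wrap₁ = ₁∼₁ (ℕ.+-monoʳ-< 1 (ℕ.+-monoˡ-< 1 (1<2*n 1≤n)))
rank-descends {n} 1≤n cc-wrap₂ = ₁∼₁ (ℕ.+-monoˡ-< (cycLen n) (1<2*n 1≤n))
rank-descends 1≤n (ac _) = ₁∼₂

lemma3 : (n : ℕ) → 2 ≤ n → (v : Vtx n) → ¬ TransClosure (Arc n) v v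
lemma3 n 2≤n = ranked⇒acyclic ≺-isStrictPartialOrder rank (rank-descends (ℕ.<⇒≤ 2≤n))
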